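{- Let $G_1$ and $G_2$ be finite graphs on $n_1$ and $n_2$ vertices respectively. If $G_1^{\mathrm{claw}}\cong G_2^{\mathrm{claw}}$, then $\mathcal{B}_{\geq n_1-1}(G_1)\cong\mathcal{B}_{\geq n_2-1}(G_2)$.
   Context: Graphs are finite and simple; $\overline{H}$ denotes the complement of $H$. $G^{\mathrm{claw}}$ is the graph whose complement is obtained from $\overline{G}$ by deleting all isolated vertices and replacing every connected component isomorphic to a triangle $K_3$ by a component isomorphic to the claw $K_{1,3}$ (the three triangle vertices become the leaves, attached to a new centre vertex). An independent set partition of $G$ is a partition of $V(G)$ into nonempty independent sets (parts). For such a partition $P$ and $v\in V(G)$, let $P-v$ be the partition of $V(G)\setminus\{v\}$ obtained by deleting $v$ from its part (discarding that part if empty). The Bell colouring graph $\mathcal{B}(G)$ has as vertices the independent set partitions of $G$, with $P\neq Q$ adjacent iff $P-v=Q-v$ for some $v\in V(G)$; $\mathcal{B}_{\geq k}(G)$ is its induced subgraph on partitions with at least $k$ parts. -}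

module Defs where

open import Data.Nat using (ℕ; _≤_; _<ᵇ_; _∸_)
open import Data.Bool using (Bool; true; false; not; _∧_; _∨_; T)
open import Data.Fin using (Fin; toℕ)
open import Data.Fin.Properties using (_≟_)
open import Data.List using (List; allFin; filterᵇ; length)
open import Data.Bool.ListAction using (all; any)
open import Data.Vec using (Vec; lookup)
open import Data.Product using (Σ; _×_; _,_; proj₁; proj₂)
open import Data.Sum using (_⊎_; inj₁; inj₂)
open import Relation.Nullary using (¬_)
open import Relation.Nullary.Decidable using (⌊_⌋)
open import Relation.Binary.PropositionalEquality using (_≡_; _≢_)
open import Function.Bundles using (_↔_; _⇔_; Inverse)

record Graph (n : ℕ) : Set where
  field
    adj    : Fin n → Fin n → Bool
    sym    : ∀ x y → adj x y ≡ adj y x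
    irrefl : ∀ x → adj x x ≡ false

open Graph public

_==_ : ∀ {n} → Fin n → Fin n → Bool
x == y = ⌊ x ≟ y ⌋

∀ᵇ : ∀ {n} → (Fin n → Bool) → Bool
∀ᵇ {n} p = all p (allFin n)

∃ᵇ : ∀ {n} → (Fin n → Bool) → Bool
∃ᵇ {n} p = any p (allFin n)

record SGraph : Set₁ where
  field
    V : Set
    E : V → V → Set

open SGraph public

_≅_ : SGraph → SGraph → Set
G ≅ H = Σ (V G ↔ V H) λ f →
          ∀ x y → E G x y ⇔ E H (Inverse.to f x) (Inverse.to f y)

module Claw {n : ℕ} (G : Graph n) where

  cadj : Fin n → Fin n → Bool
  cadj x y = not (adj G x y) ∧ not (x == y)

  isoC : Fin n → Bool
  isoC x = ∀ᵇ λ y → not (cadj x y)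

  Triple : Set
  Triple = Fin n × Fin n × Fin n

  _∈ᵗ_ : Fin n → Triple → Bool
  x ∈ᵗ (a , b , c) = (x == a) ∨ (x == b) ∨ (x == c)

  -- (a , b , c) with a < b < c is the vertex set of a connected component
  -- of the complement that is isomorphic to K₃: pairwise adjacent in the
  -- complement, and no complement edge leaves {a , b , c}.
  isTri : Triple → Bool
  isTri t@(a , b , c) =
    (toℕ a <ᵇ toℕ b) ∧ (toℕ b <ᵇ toℕ c)
    ∧ cadj a b ∧ cadj b c ∧ cadj a c
    ∧ (∀ᵇ λ x → ∀ᵇ λ y → not (x ∈ᵗ t) ∨ not (cadj x y) ∨ (y ∈ᵗ t))

  sameTri : Fin n → Fin n → Bool
  sameTri x y = ∃ᵇ λ a → ∃ᵇ λ b → ∃ᵇ λ c →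
                  isTri (a , b , c) ∧ (x ∈ᵗ (a , b , c)) ∧ (y ∈ᵗ (a , b , c))

  -- vertices of G^claw: non-isolated vertices of the complement, plus one
  -- new centre vertex for each triangle component of the complement
  ClawV : Set
  ClawV = (Σ (Fin n) λ x → T (not (isoC x))) ⊎ (Σ Triple λ t → T (isTri t))

  -- adjacency in the complement of G^claw
  H : ClawV → ClawV → Set
  H (inj₁ (x , _)) (inj₁ (y , _)) = T (cadj x y ∧ not (sameTri x y))
  H (inj₁ (x , _)) (inj₂ (t , _)) = T (x ∈ᵗ t)
  H (inj₂ (t , _)) (inj₁ (y , _)) = T (y ∈ᵗ t)
  H (inj₂ _)       (inj₂ _)       = T false

  claw : SGraph
  claw = record { V = ClawV ; E = λ u v → u ≢ v × ¬ H u v }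

_ᶜˡᵃʷ : ∀ {n} → Graph n → SGraph
G ᶜˡᵃʷ = Claw.claw G

-- Independent set partitions, encoded by the (Bool matrix of the)
-- equivalence relation "x and y are in the same part".

module Bell {n : ℕ} (G : Graph n) where

  Rel : Set
  Rel = Vec (Vec Bool n) n

  rel : Rel → Fin n → Fin n → Bool
  rel R x y = lookup (lookup R x) y

  isISPartition : Rel → Bool
  isISPartition R = ∀ᵇ λ x → ∀ᵇ λ y → ∀ᵇ λ z →
      rel R x x
    ∧ (not (rel R x y) ∨ rel R y x)
    ∧ (not (rel R x y) ∨ not (rel R y z) ∨ rel R x z)
    ∧ (not (rel R x y) ∨ not (adj G x y))

  -- number of parts = number of vertices that are the least of their part
  numParts : Rel → ℕ
  numParts R = length (filterᵇ (λ x → ∀ᵇ λ y → not (toℕ y <ᵇ toℕ x) ∨ not (rel R x y))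
                              (allFin n))

  ISPartition : Set
  ISPartition = Σ Rel λ R → T (isISPartition R)

  sameMinus : ISPartition → ISPartition → Fin n → Set
  sameMinus P Q v = ∀ x y → x ≢ v → y ≢ v → rel (proj₁ P) x y ≡ rel (proj₁ Q) x y

  B≥ : ℕ → SGraph
  B≥ k = record
    { V = Σ ISPartition λ P → k ≤ numParts (proj₁ P)
    ; E = λ P Q → proj₁ P ≢ proj₁ Q × Σ (Fin n) (sameMinus (proj₁ P) (proj₁ Q))
    }

𝓑≥ : ∀ {n} → Graph n → ℕ → SGraph
𝓑≥ G k = Bell.B≥ G k

-- The independent set partitions with at least n − 1 parts are the discrete partition and, for each
-- non-edge xy of G, the partition merging x and y. The discrete partition is adjacent to all others,
-- and two merges are adjacent exactly when their non-edges share a vertex v (then P − v = Q − v), so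
-- B≥(n − 1)(G) is the cone over the line graph of the complement of G. That line graph is also the
-- line graph of the complement of G^claw: deleting isolated vertices does not change it, and a
-- triangle component of the complement and the claw replacing it have the same line graph, a side of
-- the triangle corresponding to the spoke towards the opposite corner. An isomorphism of the claw
-- graphs is one of their complements, hence of the line graphs and of the cones over them.

{-# OPTIONS --safe #-}
module Submission where

open import Defs hiding (sym)
open import Data.Bool using (Bool; true; false; not; _∧_; _∨_; T)
open import Data.Bool.Properties using (T-∧; T-∨; T-irrelevant)
open import Data.Empty using (⊥; ⊥-elim)
open import Data.Fin using (Fin; toℕ; _<_)
import Data.Fin as Fin
open import Data.Fin.Patterns using (0F; 1F; 2F)
open import Data.Fin.Properties using (_≟_; _<?_; <-cmp; <-irrelevant; <-asym; <⇒≢; <-irrefl; ≤-antisym; all?; any?)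
open import Data.List using ([]; _∷_; allFin; filter; length)
open import Data.List.Properties using (filter-all; filter-notAll; filter-reject; length-tabulate)
open import Data.List.Membership.Propositional using (_∈_; lose)
open import Data.List.Membership.Propositional.Properties using (∈-allFin)
import Data.List.Relation.Unary.All as All
open import Data.List.Relation.Unary.All.Properties using (all⁺; all⁻)
open import Data.List.Relation.Unary.Any using (here; there; satisfied)
open import Data.List.Relation.Unary.AllPairs using (_∷_)
open import Data.List.Relation.Unary.Unique.Propositional using (Unique)
open import Data.List.Relation.Unary.Unique.Propositional.Properties using (allFin⁺)
open import Data.List.Relation.Unary.Any.Properties using (any⁺; any⁻)
open import Data.Nat using (ℕ; suc; _∸_; _+_; _≤_; _<ᵇ_; z≤n; s≤s)
import Data.Nat.Properties as ℕ
open import Data.Nat.Properties using (<ᵇ⇒<; <⇒<ᵇ)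
open import Data.Product using (Σ; ∃; _×_; _,_; proj₁; proj₂; uncurry)
open import Data.Product.Function.NonDependent.Propositional using (_×-⇔_)
import Data.Product as Product
open import Data.Sum using (_⊎_; inj₁; inj₂; [_,_])
open import Data.Sum.Function.Propositional using (_⊎-⇔_)
open import Data.Sum.Properties using (inj₁-injective; inj₂-injective)
import Data.Sum as Sum
open import Data.Unit using (⊤; tt)
open import Data.Vec using (tabulate; lookup)
open import Data.Vec.Properties using (lookup∘tabulate; tabulate∘lookup; tabulate-cong)
open import Function using (_∘_; id; case_of_)
open import Function.Bundles using (_↔_; _⇔_; Inverse; Injection; Equivalence; mk⇔; mk↔ₛ′)
open import Function.Construct.Composition using (_⇔-∘_)
open import Function.Construct.Identity using (⇔-id)
open import Function.Construct.Symmetry using (⇔-sym)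
open import Function.Definitions using (Injective)
open import Function.Properties.Equivalence using (⇔-setoid)
open import Function.Properties.Inverse using (↔-refl; ↔-sym; ↔-trans; Inverse⇒Injection)
open import Level using (0ℓ)
open import Relation.Binary.Bundles using (Setoid)
open import Relation.Binary.Definitions using (DecidableEquality; tri<; tri≈; tri>)
open import Relation.Binary.PropositionalEquality
  using (_≡_; _≢_; refl; sym; trans; cong; cong₂; subst; subst₂; module ≡-Reasoning)
import Relation.Binary.Reasoning.Setoid as SetoidReasoning
open import Relation.Nullary using (¬_; Dec; yes; no)
import Relation.Unary as U
open import Relation.Nullary.Decidable using (⌊_⌋; _×-dec_; _⊎-dec_; _→-dec_; ¬?; T?; toWitness; fromWitness)

module ⇔ = Equivalence
module ⇔-Reasoning = SetoidReasoning (⇔-setoid 0ℓ)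

T-not : ∀ {b} → T (not b) ⇔ (¬ T b)
T-not {false} = mk⇔ (λ _ ()) (λ _ → tt)
T-not {true}  = mk⇔ (λ ()) (λ ¬t → ¬t tt)

T-implies : ∀ {a b} → T (not a ∨ b) ⇔ (T a → T b)
T-implies {false}         = mk⇔ (λ _ ()) (λ _ → tt)
T-implies {true} {true}   = mk⇔ (λ _ _ → tt) (λ _ → tt)
T-implies {true} {false}  = mk⇔ (λ ()) (λ f → f tt)

T-implies₂ : ∀ {a b c} → T (not a ∨ not b ∨ c) ⇔ (T a → T b → T c)
T-implies₂ {a} {b} {c} = mk⇔ (λ h → ⇔.to (T-implies {b} {c}) ∘ ⇔.to (T-implies {a}) h)
                             (λ f → ⇔.from (T-implies {a}) (⇔.from (T-implies {b} {c}) ∘ f))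

T-implies-not : ∀ {a b} → T (not a ∨ not b) ⇔ (T a → ¬ T b)
T-implies-not {a} {b} = mk⇔ (λ h → ⇔.to (T-not {b}) ∘ ⇔.to (T-implies {a}) h)
                            (λ f → ⇔.from (T-implies {a}) (⇔.from (T-not {b}) ∘ f))

∀ᵇ⇔ : ∀ {n} {p : Fin n → Bool} → T (∀ᵇ p) ⇔ (∀ x → T (p x))
∀ᵇ⇔ {n} {p} = mk⇔ (λ h x → All.lookup (all⁺ p (allFin n) h) (∈-allFin x))
                   (λ f → all⁻ p {allFin n} (All.tabulate (λ {x} _ → f x)))

∃ᵇ⇔ : ∀ {n} {p : Fin n → Bool} → T (∃ᵇ p) ⇔ ∃ (λ x → T (p x))
∃ᵇ⇔ {n} {p} = mk⇔ (satisfied ∘ any⁻ p (allFin n))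
                   (λ (x , px) → any⁺ p (lose {xs = allFin n} (∈-allFin x) px))

T-injective : ∀ {a b} → T a ⇔ T b → a ≡ b
T-injective {false} {false} _ = refl
T-injective {false} {true}  e = ⊥-elim (⇔.from e tt)
T-injective {true}  {false} e = ⊥-elim (⇔.to e tt)
T-injective {true}  {true}  _ = refl

T-⌊⌋ : ∀ {P : Set} {P? : Dec P} → T ⌊ P? ⌋ ⇔ P
T-⌊⌋ = mk⇔ toWitness fromWitness

T-== : ∀ {n} {x y : Fin n} → T (x == y) ⇔ x ≡ y
T-== = T-⌊⌋

T-∧⁴ : ∀ a b c d → T (a ∧ b ∧ c ∧ d) ⇔ (T a × T b × T c × T d)
T-∧⁴ a b c d = (⇔-id _ ×-⇔ ((⇔-id _ ×-⇔ T-∧ {c} {d}) ⇔-∘ T-∧ {b})) ⇔-∘ T-∧ {a}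

-- Graph isomorphisms, complements and cones

to-injective : ∀ {A B : Set} (f : A ↔ B) → Injective _≡_ _≡_ (Inverse.to f)
to-injective f = Injection.injective (Inverse⇒Injection f)

≅-sym : ∀ {Γ Δ} → Γ ≅ Δ → Δ ≅ Γ
≅-sym {Γ} {Δ} (f , f-pres) = ↔-sym f , λ x y →
  ⇔-sym (subst₂ (λ u v → E Γ (from x) (from y) ⇔ E Δ u v)
                (strictlyInverseˡ x) (strictlyInverseˡ y) (f-pres (from x) (from y)))
  where open Inverse f

≅-trans : ∀ {Γ Δ Θ} → Γ ≅ Δ → Δ ≅ Θ → Γ ≅ Θ
≅-trans (f , f-pres) (g , g-pres) = ↔-trans f g , λ x y → g-pres _ _ ⇔-∘ f-pres x y

≅-setoid : Setoid _ _
≅-setoid = record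
  { Carrier       = SGraph
  ; _≈_           = _≅_
  ; isEquivalence = record
    { refl  = ↔-refl , λ _ _ → ⇔-id _
    ; sym   = λ {Γ} {Δ} → ≅-sym {Γ} {Δ}
    ; trans = λ {Γ} {Δ} {Θ} → ≅-trans {Γ} {Δ} {Θ}
    }
  }

module ≅-Reasoning = SetoidReasoning ≅-setoid

complement : SGraph → SGraph
complement Γ = record { V = V Γ ; E = λ u v → u ≢ v × ¬ E Γ u v }

-- An isomorphism preserves non-adjacency of distinct vertices, hence adjacency when it is decidable.
complement-reflects-≅ : ∀ {Γ Δ}
  → (∀ u v → Dec (E Γ u v)) → (∀ u v → Dec (E Δ u v))
  → (∀ u → ¬ E Γ u u) → (∀ u → ¬ E Δ u u)
  → complement Γ ≅ complement Δ → Γ ≅ Δ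
complement-reflects-≅ {Γ} {Δ} E?Γ E?Δ irrΓ irrΔ (f , f-pres) = f , λ u v → mk⇔ (⇒ u v) (⇐ u v)
  where
  open Inverse f using () renaming (to to φ)
  ⇒ : ∀ u v → E Γ u v → E Δ (φ u) (φ v)
  ⇒ u v e with E?Δ (φ u) (φ v)
  ... | yes e′ = e′
  ... | no ¬e′ = ⊥-elim (proj₂ (⇔.from (f-pres u v) (φu≢φv , ¬e′)) e)
    where
    φu≢φv : φ u ≢ φ v
    φu≢φv eq = irrΓ v (subst (λ w → E Γ w v) (to-injective f eq) e)
  ⇐ : ∀ u v → E Δ (φ u) (φ v) → E Γ u v
  ⇐ u v e with E?Γ u v
  ... | yes e′ = e′
  ... | no ¬e′ = ⊥-elim (proj₂ (⇔.to (f-pres u v) (u≢v , ¬e′)) e)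
    where
    u≢v : u ≢ v
    u≢v refl = irrΔ (φ u) e

ConeE : (Γ : SGraph) → ⊤ ⊎ V Γ → ⊤ ⊎ V Γ → Set
ConeE Γ (inj₁ _) (inj₁ _) = ⊥
ConeE Γ (inj₁ _) (inj₂ _) = ⊤
ConeE Γ (inj₂ _) (inj₁ _) = ⊤
ConeE Γ (inj₂ u) (inj₂ v) = E Γ u v

Cone : SGraph → SGraph
Cone Γ = record { V = ⊤ ⊎ V Γ ; E = ConeE Γ }

Cone-cong : ∀ {Γ Δ} → Γ ≅ Δ → Cone Γ ≅ Cone Δ
Cone-cong {Γ} {Δ} (f , f-pres) =
  mk↔ₛ′ (Sum.map₂ to) (Sum.map₂ from) (map₂-inverse strictlyInverseˡ) (map₂-inverse strictlyInverseʳ)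
  , pres
  where
  open Inverse f
  map₂-inverse : ∀ {A B} {g : A → B} {h : B → A}
    → (∀ x → g (h x) ≡ x) → ∀ x → Sum.map₂ g (Sum.map₂ h x) ≡ x
  map₂-inverse gh (inj₁ tt) = refl
  map₂-inverse gh (inj₂ x)  = cong inj₂ (gh x)
  pres : ∀ u v → ConeE Γ u v ⇔ ConeE Δ (Sum.map₂ to u) (Sum.map₂ to v)
  pres (inj₁ _) (inj₁ _) = ⇔-id _
  pres (inj₁ _) (inj₂ _) = ⇔-id _
  pres (inj₂ _) (inj₁ _) = ⇔-id _
  pres (inj₂ u) (inj₂ v) = f-pres u v

-- Unordered pairs and line graphs

module _ {A : Set} where
  infix 4 _≈ᵤ_ _∈ₑ_

  _≈ᵤ_ : A × A → A × A → Set
  (p , q) ≈ᵤ (p′ , q′) = (p ≡ p′ × q ≡ q′) ⊎ (p ≡ q′ × q ≡ p′)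

  _∈ₑ_ : A → A × A → Set
  x ∈ₑ (p , q) = x ≡ p ⊎ x ≡ q

  LineAdjacent : A × A → A × A → Set
  LineAdjacent a b = ¬ a ≈ᵤ b × ∃ λ x → x ∈ₑ a × x ∈ₑ b

  ≈ᵤ-refl : ∀ {a} → a ≈ᵤ a
  ≈ᵤ-refl = inj₁ (refl , refl)

  ≈ᵤ-swap : ∀ {p q} → (p , q) ≈ᵤ (q , p)
  ≈ᵤ-swap = inj₂ (refl , refl)

  ≈ᵤ-reflexive : ∀ {a b} → a ≡ b → a ≈ᵤ b
  ≈ᵤ-reflexive refl = ≈ᵤ-refl

  ≈ᵤ-sym : ∀ {p q p′ q′} → (p , q) ≈ᵤ (p′ , q′) → (p′ , q′) ≈ᵤ (p , q)
  ≈ᵤ-sym (inj₁ (refl , refl)) = ≈ᵤ-refl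
  ≈ᵤ-sym (inj₂ (refl , refl)) = ≈ᵤ-swap

  ≈ᵤ-trans : ∀ {p q p′ q′ p″ q″}
    → (p , q) ≈ᵤ (p′ , q′) → (p′ , q′) ≈ᵤ (p″ , q″) → (p , q) ≈ᵤ (p″ , q″)
  ≈ᵤ-trans (inj₁ (refl , refl)) bc                   = bc
  ≈ᵤ-trans (inj₂ (refl , refl)) (inj₁ (refl , refl)) = ≈ᵤ-swap
  ≈ᵤ-trans (inj₂ (refl , refl)) (inj₂ (refl , refl)) = ≈ᵤ-refl

  ≈ᵤ? : DecidableEquality A → ∀ a b → Dec (a ≈ᵤ b)
  ≈ᵤ? _≟_ (p , q) (p′ , q′) = ((p ≟ p′) ×-dec (q ≟ q′)) ⊎-dec ((p ≟ q′) ×-dec (q ≟ p′))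

  ∈ₑ-resp-≈ᵤ : ∀ {x p q p′ q′} → x ∈ₑ (p , q) → (p , q) ≈ᵤ (p′ , q′) → x ∈ₑ (p′ , q′)
  ∈ₑ-resp-≈ᵤ x∈ (inj₁ (refl , refl)) = x∈
  ∈ₑ-resp-≈ᵤ x∈ (inj₂ (refl , refl)) = Sum.swap x∈

  LineAdjacent-resp-≈ᵤ : ∀ {p q p′ q′ r s r′ s′} → (p , q) ≈ᵤ (p′ , q′) → (r , s) ≈ᵤ (r′ , s′)
    → LineAdjacent (p , q) (r , s) → LineAdjacent (p′ , q′) (r′ , s′)
  LineAdjacent-resp-≈ᵤ a≈ b≈ (a≉b , x , x∈a , x∈b) =
    (λ a′≈b′ → a≉b (≈ᵤ-trans a≈ (≈ᵤ-trans a′≈b′ (≈ᵤ-sym b≈))))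
    , x , ∈ₑ-resp-≈ᵤ x∈a a≈ , ∈ₑ-resp-≈ᵤ x∈b b≈

  LineAdjacent-sym : ∀ {p q r s} → LineAdjacent (p , q) (r , s) → LineAdjacent (r , s) (p , q)
  LineAdjacent-sym (a≉b , x , x∈a , x∈b) = a≉b ∘ ≈ᵤ-sym , x , x∈b , x∈a

  LineAdjacent-sharedʳ : ∀ {p q c} → LineAdjacent (p , c) (q , c) ⇔ p ≢ q
  LineAdjacent-sharedʳ = mk⇔ (λ (≉ , _) p≡q → ≉ (inj₁ (p≡q , refl)))
                             (λ p≢q → ≉ p≢q , _ , inj₂ refl , inj₂ refl)
    where
    ≉ : ∀ {p q c} → p ≢ q → ¬ (p , c) ≈ᵤ (q , c)
    ≉ p≢q (inj₁ (p≡q , _))        = p≢q p≡q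
    ≉ p≢q (inj₂ (refl , refl)) = p≢q refl

injective⇒≢⇔ : ∀ {A B : Set} {f : A → B} → Injective _≡_ _≡_ f → ∀ {x y} → (x ≢ y) ⇔ (f x ≢ f y)
injective⇒≢⇔ {f = f} f-injective = mk⇔ (λ x≢y → x≢y ∘ f-injective) (λ fx≢fy → fx≢fy ∘ cong f)

both : ∀ {A B : Set} → (A → B) → A × A → B × B
both f = Product.map f f

module _ {A B : Set} (f : A → B) where

  ≈ᵤ-map : ∀ {p q p′ q′} → (p , q) ≈ᵤ (p′ , q′) → both f (p , q) ≈ᵤ both f (p′ , q′)
  ≈ᵤ-map (inj₁ (refl , refl)) = ≈ᵤ-refl
  ≈ᵤ-map (inj₂ (refl , refl)) = ≈ᵤ-swap

  module _ (f-injective : Injective _≡_ _≡_ f) where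

    ≈ᵤ-map⁻ : ∀ {p q p′ q′} → both f (p , q) ≈ᵤ both f (p′ , q′) → (p , q) ≈ᵤ (p′ , q′)
    ≈ᵤ-map⁻ (inj₁ (e , e′)) = inj₁ (f-injective e , f-injective e′)
    ≈ᵤ-map⁻ (inj₂ (e , e′)) = inj₂ (f-injective e , f-injective e′)

    ∈ₑ-map⁻ : ∀ {x p q} → f x ∈ₑ both f (p , q) → x ∈ₑ (p , q)
    ∈ₑ-map⁻ = Sum.map f-injective f-injective

    LineAdjacent-map : ∀ {p q r s}
      → LineAdjacent (p , q) (r , s) ⇔ LineAdjacent (both f (p , q)) (both f (r , s))
    LineAdjacent-map {p} {q} = mk⇔
      (λ (a≉b , x , x∈a , x∈b) → a≉b ∘ ≈ᵤ-map⁻ , f x , Sum.map (cong f) (cong f) x∈a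
                                                     , Sum.map (cong f) (cong f) x∈b)
      (λ (a≉b , y , y∈a , y∈b) → a≉b ∘ ≈ᵤ-map , preimage y∈a y∈b)
      where
      preimage : ∀ {y r s} → y ∈ₑ (f p , f q) → y ∈ₑ (f r , f s)
        → ∃ λ x → x ∈ₑ (p , q) × x ∈ₑ (r , s)
      preimage (inj₁ refl) y∈b = p , inj₁ refl , ∈ₑ-map⁻ y∈b
      preimage (inj₂ refl) y∈b = q , inj₂ refl , ∈ₑ-map⁻ y∈b

Arc : SGraph → Set
Arc Δ = Σ (V Δ × V Δ) (uncurry (E Δ))

ends : ∀ {Δ} → Arc Δ → V Δ × V Δ
ends = proj₁

-- Γ is the line graph of Δ, whose edges are the arcs of Δ up to orientation.
record IsLineGraph (Γ Δ : SGraph) : Set where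
  field
    edge      : Arc Δ → V Γ
    arc       : V Γ → Arc Δ
    edge-arc  : ∀ e → edge (arc e) ≡ e
    arc-edge  : ∀ a → ends (arc (edge a)) ≈ᵤ ends a
    edge-cong : ∀ a b → ends a ≈ᵤ ends b → edge a ≡ edge b
    adjacent  : ∀ e e′ → E Γ e e′ ⇔ LineAdjacent (ends (arc e)) (ends (arc e′))

mapArc : ∀ {Δ₁ Δ₂} → Δ₁ ≅ Δ₂ → Arc Δ₁ → Arc Δ₂
mapArc (f , f-pres) ((u , v) , uv) = both (Inverse.to f) (u , v) , ⇔.to (f-pres u v) uv

transport : ∀ {Γ₁ Γ₂ Δ₁ Δ₂}
  → IsLineGraph Γ₁ Δ₁ → IsLineGraph Γ₂ Δ₂ → Δ₁ ≅ Δ₂ → V Γ₁ → V Γ₂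
transport L₁ L₂ φ = IsLineGraph.edge L₂ ∘ mapArc φ ∘ IsLineGraph.arc L₁

module _ {Γ₁ Γ₂ Δ₁ Δ₂} (L₁ : IsLineGraph Γ₁ Δ₁) (L₂ : IsLineGraph Γ₂ Δ₂) where
  open IsLineGraph

  transport-adjacent : ∀ φ e e′ → E Γ₁ e e′ ⇔ E Γ₂ (transport L₁ L₂ φ e) (transport L₁ L₂ φ e′)
  transport-adjacent φ@(f , _) e e′ = begin
    E Γ₁ e e′                                           ≈⟨ adjacent L₁ e e′ ⟩
    LineAdjacent (ends (arc L₁ e)) (ends (arc L₁ e′))   ≈⟨ LineAdjacent-map (Inverse.to f) (to-injective f) ⟩
    LineAdjacent (ends a) (ends a′)
      ≈⟨ mk⇔ (LineAdjacent-resp-≈ᵤ (≈ᵤ-sym (arc-edge L₂ a)) (≈ᵤ-sym (arc-edge L₂ a′)))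
             (LineAdjacent-resp-≈ᵤ (arc-edge L₂ a) (arc-edge L₂ a′)) ⟩
    LineAdjacent (ends (arc L₂ (edge L₂ a))) (ends (arc L₂ (edge L₂ a′))) ≈⟨ adjacent L₂ _ _ ⟨
    E Γ₂ (transport L₁ L₂ φ e) (transport L₁ L₂ φ e′)   ∎
    where
    open ⇔-Reasoning
    a a′ : Arc Δ₂
    a  = mapArc φ (arc L₁ e)
    a′ = mapArc φ (arc L₁ e′)

  transport-inverse : (φ : Δ₁ ≅ Δ₂) (ψ : Δ₂ ≅ Δ₁)
    → (∀ u → Inverse.to (proj₁ ψ) (Inverse.to (proj₁ φ) u) ≡ u)
    → ∀ e → transport L₂ L₁ ψ (transport L₁ L₂ φ e) ≡ e
  transport-inverse φ ψ ψφ e = trans (edge-cong L₁ _ _ ends≈) (edge-arc L₁ e)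
    where
    g = Inverse.to (proj₁ ψ)
    a = mapArc φ (arc L₁ e)
    ends≈ : both g (ends (arc L₂ (edge L₂ a))) ≈ᵤ ends (arc L₁ e)
    ends≈ = subst (both g (ends (arc L₂ (edge L₂ a))) ≈ᵤ_) (cong₂ _,_ (ψφ _) (ψφ _))
                  (≈ᵤ-map g (arc-edge L₂ a))

IsLineGraph-≅ : ∀ {Γ₁ Γ₂ Δ₁ Δ₂} → IsLineGraph Γ₁ Δ₁ → IsLineGraph Γ₂ Δ₂
  → Δ₁ ≅ Δ₂ → Γ₁ ≅ Γ₂
IsLineGraph-≅ {Δ₁ = Δ₁} {Δ₂} L₁ L₂ φ@(f , _) =
  mk↔ₛ′ (transport L₁ L₂ φ) (transport L₂ L₁ φ⁻¹)
        (transport-inverse L₂ L₁ φ⁻¹ φ (Inverse.strictlyInverseˡ f))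
        (transport-inverse L₁ L₂ φ φ⁻¹ (Inverse.strictlyInverseʳ f))
  , transport-adjacent L₁ L₂ φ
  where
  φ⁻¹ = ≅-sym {Δ₁} {Δ₂} φ

-- The complement of G and the claw construction

module ComplementEdges {n : ℕ} (G : Graph n) where
  open Claw G using (cadj)

  cadj⇔ : ∀ {x y} → T (cadj x y) ⇔ (¬ T (adj G x y) × x ≢ y)
  cadj⇔ = mk⇔ (Product.map (⇔.to T-not) (λ x≢ᵇy → ⇔.to T-not x≢ᵇy ∘ ⇔.from T-==) ∘ ⇔.to T-∧)
              (⇔.from T-∧ ∘ Product.map (⇔.from T-not) (λ x≢y → ⇔.from T-not (x≢y ∘ ⇔.to T-==)))

  cadj-sym : ∀ {x y} → T (cadj x y) → T (cadj y x)
  cadj-sym {x} {y} h with ¬adj , x≢y ← ⇔.to cadj⇔ h =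
    ⇔.from cadj⇔ (subst (λ b → ¬ T b) (Graph.sym G x y) ¬adj , x≢y ∘ sym)

  cadj⇒≢ : ∀ {x y} → T (cadj x y) → x ≢ y
  cadj⇒≢ = proj₂ ∘ ⇔.to cadj⇔

  CoEdge : Set
  CoEdge = Σ (Fin n × Fin n) λ (x , y) → x < y × T (cadj x y)

  LineOfComplement : SGraph
  LineOfComplement = record { V = CoEdge ; E = λ e e′ → LineAdjacent (proj₁ e) (proj₁ e′) }

  CoEdge-≡ : ∀ {e e′ : CoEdge} → proj₁ e ≈ᵤ proj₁ e′ → e ≡ e′
  CoEdge-≡ {_ , x<y , h} {_ , x<y′ , h′} (inj₁ (refl , refl)) =
    cong (λ p → _ , p) (cong₂ _,_ (<-irrelevant x<y x<y′) (T-irrelevant h h′))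
  CoEdge-≡ {_ , x<y , _} {_ , y<x , _} (inj₂ (refl , refl)) = ⊥-elim (<-asym x<y y<x)

  coEdge : ∀ {x y} → T (cadj x y) → CoEdge
  coEdge {x} {y} h with <-cmp x y
  ... | tri< x<y _ _ = (x , y) , x<y , h
  ... | tri≈ _ x≡y _ = ⊥-elim (cadj⇒≢ h x≡y)
  ... | tri> _ _ y<x = (y , x) , y<x , cadj-sym h

  coEdge-ends : ∀ {x y} (h : T (cadj x y)) → (x , y) ≈ᵤ proj₁ (coEdge h)
  coEdge-ends {x} {y} h with <-cmp x y
  ... | tri< _ _ _   = ≈ᵤ-refl
  ... | tri≈ _ x≡y _ = ⊥-elim (cadj⇒≢ h x≡y)
  ... | tri> _ _ _   = ≈ᵤ-swap

  coEdge-cong : ∀ {x y x′ y′} (h : T (cadj x y)) (h′ : T (cadj x′ y′))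
    → (x , y) ≈ᵤ (x′ , y′) → coEdge h ≡ coEdge h′
  coEdge-cong h h′ xy≈ = CoEdge-≡ (≈ᵤ-trans (≈ᵤ-sym (coEdge-ends h)) (≈ᵤ-trans xy≈ (coEdge-ends h′)))

side : Fin 3 → Fin 3 × Fin 3
side 0F = 1F , 2F
side 1F = 0F , 2F
side 2F = 0F , 1F

opposite : Fin 3 × Fin 3 → Fin 3
opposite (0F , 1F) = 2F
opposite (1F , 0F) = 2F
opposite (0F , 2F) = 1F
opposite (2F , 0F) = 1F
opposite (1F , 2F) = 0F
opposite (2F , 1F) = 0F
opposite _         = 0F  -- a diagonal pair is not a side; the value is irrelevant

opposite-side : ∀ k → opposite (side k) ≡ k
opposite-side 0F = refl
opposite-side 1F = refl
opposite-side 2F = refl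

side-distinct : ∀ k → proj₁ (side k) ≢ proj₂ (side k)
side-distinct 0F ()
side-distinct 1F ()
side-distinct 2F ()

side-opposite : ∀ {i j} → i ≢ j → side (opposite (i , j)) ≈ᵤ (i , j)
side-opposite {i} {j} = toWitness {a? = all? λ i → all? λ j →
  ¬? (i ≟ j) →-dec ≈ᵤ? _≟_ (side (opposite (i , j))) (i , j)} _ i j

opposite-≢ : ∀ {i j} → i ≢ j → opposite (i , j) ≢ i
opposite-≢ {i} {j} = toWitness {a? = all? λ i → all? λ j → ¬? (i ≟ j) →-dec ¬? (opposite (i , j) ≟ i)} _ i j

opposite-cong : ∀ {i j k l} → (i , j) ≈ᵤ (k , l) → opposite (i , j) ≡ opposite (k , l)
opposite-cong (inj₁ (refl , refl)) = refl
opposite-cong {i} {j} (inj₂ (refl , refl)) =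
  toWitness {a? = all? λ i → all? λ j → opposite (i , j) ≟ opposite (j , i)} _ i j

sides-meet : ∀ {i j k l : Fin 3} → i ≢ j → k ≢ l → ∃ λ m → m ∈ₑ (i , j) × m ∈ₑ (k , l)
sides-meet {i} {j} {k} {l} = toWitness {a? = all? λ i → all? λ j → all? λ k → all? λ l →
  ¬? (i ≟ j) →-dec ¬? (k ≟ l) →-dec
  any? λ m → ((m ≟ i) ⊎-dec (m ≟ j)) ×-dec ((m ≟ k) ⊎-dec (m ≟ l))} _ i j k l

LineAdjacent-opposite : ∀ {i j k l : Fin 3} → i ≢ j → k ≢ l
  → LineAdjacent (i , j) (k , l) ⇔ opposite (i , j) ≢ opposite (k , l)
LineAdjacent-opposite i≢j k≢l = mk⇔
  (λ (≉ , _) opp≡ → ≉ (≈ᵤ-trans (≈ᵤ-sym (side-opposite i≢j))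
                                 (subst (λ m → side m ≈ᵤ _) (sym opp≡) (side-opposite k≢l))))
  (λ opp≢ → opp≢ ∘ opposite-cong , sides-meet i≢j k≢l)

module ClawComplement {n : ℕ} (G : Graph n) where
  open Claw G
  open ComplementEdges G

  coClaw : SGraph
  coClaw = record { V = ClawV ; E = H }

  corner : Triple → Fin 3 → Fin n
  corner (a , b , c) 0F = a
  corner (a , b , c) 1F = b
  corner (a , b , c) 2F = c

  ∈ᵗ⇔ : ∀ x t → T (x ∈ᵗ t) ⇔ ∃ λ i → x ≡ corner t i
  ∈ᵗ⇔ x t@(a , b , c) = mk⇔ position at-corner
    where
    ∈ᵗ⇔⊎ : T (x ∈ᵗ t) ⇔ (T (x == a) ⊎ T (x == b) ⊎ T (x == c))
    ∈ᵗ⇔⊎ = (⇔-id _ ⊎-⇔ T-∨) ⇔-∘ T-∨ {x == a} {(x == b) ∨ (x == c)}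
    position : T (x ∈ᵗ t) → ∃ λ i → x ≡ corner t i
    position h with ⇔.to ∈ᵗ⇔⊎ h
    ... | inj₁ x≡a        = 0F , ⇔.to T-== x≡a
    ... | inj₂ (inj₁ x≡b) = 1F , ⇔.to T-== x≡b
    ... | inj₂ (inj₂ x≡c) = 2F , ⇔.to T-== x≡c
    at-corner : ∃ (λ i → x ≡ corner t i) → T (x ∈ᵗ t)
    at-corner (0F , refl) = ⇔.from ∈ᵗ⇔⊎ (inj₁ (⇔.from T-== refl))
    at-corner (1F , refl) = ⇔.from ∈ᵗ⇔⊎ (inj₂ (inj₁ (⇔.from T-== refl)))
    at-corner (2F , refl) = ⇔.from ∈ᵗ⇔⊎ (inj₂ (inj₂ (⇔.from T-== refl)))

  corner-∈ᵗ : ∀ t i → T (corner t i ∈ᵗ t)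
  corner-∈ᵗ t i = ⇔.from (∈ᵗ⇔ _ t) (i , refl)

  record Triangle (t : Triple) : Set where
    field
      sorted₀₁ : corner t 0F < corner t 1F
      sorted₁₂ : corner t 1F < corner t 2F
      cadj₀₁   : T (cadj (corner t 0F) (corner t 1F))
      cadj₁₂   : T (cadj (corner t 1F) (corner t 2F))
      cadj₀₂   : T (cadj (corner t 0F) (corner t 2F))
      closed   : ∀ {x y} → T (x ∈ᵗ t) → T (cadj x y) → T (y ∈ᵗ t)

  triangle : ∀ {t} → T (isTri t) → Triangle t
  triangle h =
    let s₀₁ , h = ⇔.to T-∧ h
        s₁₂ , h = ⇔.to T-∧ h
        c₀₁ , h = ⇔.to T-∧ h
        c₁₂ , h = ⇔.to T-∧ h
        c₀₂ , h = ⇔.to T-∧ h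
    in record
      { sorted₀₁ = <ᵇ⇒< _ _ s₀₁
      ; sorted₁₂ = <ᵇ⇒< _ _ s₁₂
      ; cadj₀₁   = c₀₁
      ; cadj₁₂   = c₁₂
      ; cadj₀₂   = c₀₂
      ; closed   = λ {x} {y} → ⇔.to T-implies₂ (⇔.to ∀ᵇ⇔ (⇔.to ∀ᵇ⇔ h x) y)
      }

  module _ {t : Triple} (ht : T (isTri t)) where
    open Triangle (triangle {t} ht)

    corner-cadj : ∀ {i j} → i ≢ j → T (cadj (corner t i) (corner t j))
    corner-cadj {0F} {0F} i≢j = ⊥-elim (i≢j refl)
    corner-cadj {0F} {1F} _   = cadj₀₁
    corner-cadj {0F} {2F} _   = cadj₀₂
    corner-cadj {1F} {0F} _   = cadj-sym cadj₀₁
    corner-cadj {1F} {1F} i≢j = ⊥-elim (i≢j refl)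
    corner-cadj {1F} {2F} _   = cadj₁₂
    corner-cadj {2F} {0F} _   = cadj-sym cadj₀₂
    corner-cadj {2F} {1F} _   = cadj-sym cadj₁₂
    corner-cadj {2F} {2F} i≢j = ⊥-elim (i≢j refl)

    corner-injective : Injective _≡_ _≡_ (corner t)
    corner-injective {i} {j} eq with i ≟ j
    ... | yes i≡j = i≡j
    ... | no i≢j  = ⊥-elim (cadj⇒≢ (corner-cadj i≢j) eq)

    corner-lowest : ∀ i → corner t 0F Fin.≤ corner t i
    corner-lowest 0F = ℕ.≤-refl
    corner-lowest 1F = ℕ.<⇒≤ sorted₀₁
    corner-lowest 2F = ℕ.<⇒≤ (ℕ.<-trans sorted₀₁ sorted₁₂)

    corner-highest : ∀ i → corner t i Fin.≤ corner t 2F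
    corner-highest 0F = ℕ.<⇒≤ (ℕ.<-trans sorted₀₁ sorted₁₂)
    corner-highest 1F = ℕ.<⇒≤ sorted₁₂
    corner-highest 2F = ℕ.≤-refl

  -- A triangle is a whole component of the complement, so it contains every corner of a triangle it meets.
  corners-⊆ : ∀ {x t t′} → T (isTri t) → T (isTri t′) → T (x ∈ᵗ t) → T (x ∈ᵗ t′)
    → ∀ k → T (corner t′ k ∈ᵗ t)
  corners-⊆ {x} {t} {t′} ht ht′ x∈t x∈t′ k with ⇔.to (∈ᵗ⇔ x t′) x∈t′
  ... | i , refl with i ≟ k
  ...   | yes refl = x∈t
  ...   | no i≢k   = Triangle.closed (triangle {t} ht) x∈t (corner-cadj ht′ i≢k)

  triangle-unique : ∀ {x t t′} → T (isTri t) → T (isTri t′) → T (x ∈ᵗ t) → T (x ∈ᵗ t′) → t ≡ t′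
  triangle-unique {x} {t@(a , b , c)} {t′@(a′ , b′ , c′)} ht ht′ x∈t x∈t′ =
    cong₂ _,_ a≡a′ (cong₂ _,_ b≡b′ c≡c′)
    where
    open Triangle (triangle {t′} ht′) using (sorted₀₁; sorted₁₂)
    t′⊆t : ∀ k → ∃ λ i → corner t′ k ≡ corner t i
    t′⊆t k = ⇔.to (∈ᵗ⇔ _ t) (corners-⊆ {x} ht ht′ x∈t x∈t′ k)
    t⊆t′ : ∀ k → ∃ λ i → corner t k ≡ corner t′ i
    t⊆t′ k = ⇔.to (∈ᵗ⇔ _ t′) (corners-⊆ {x} ht′ ht x∈t′ x∈t k)
    lowest : ∀ s (hs : T (isTri s)) {y} → (∃ λ i → y ≡ corner s i) → corner s 0F Fin.≤ y
    lowest s hs (i , refl) = corner-lowest hs i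
    highest : ∀ s (hs : T (isTri s)) {y} → (∃ λ i → y ≡ corner s i) → y Fin.≤ corner s 2F
    highest s hs (i , refl) = corner-highest hs i
    a≡a′ : a ≡ a′
    a≡a′ = ≤-antisym (lowest t ht (t′⊆t 0F)) (lowest t′ ht′ (t⊆t′ 0F))
    c≡c′ : c ≡ c′
    c≡c′ = ≤-antisym (highest t′ ht′ (t⊆t′ 2F)) (highest t ht (t′⊆t 2F))
    b≡b′ : b ≡ b′
    b≡b′ with t′⊆t 1F
    ... | 0F , b′≡a = ⊥-elim (<-irrefl (trans (sym a≡a′) (sym b′≡a)) sorted₀₁)
    ... | 1F , b′≡b = sym b′≡b
    ... | 2F , b′≡c = ⊥-elim (<-irrefl (trans b′≡c c≡c′) sorted₁₂)

  nonIsolated : ∀ {x y} → T (cadj x y) → T (not (isoC x))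
  nonIsolated {x} {y} h = ⇔.from T-not (λ isolated → ⇔.to T-not (⇔.to ∀ᵇ⇔ isolated y) h)

  vertex : ∀ {x y} → T (cadj x y) → ClawV
  vertex {x} h = inj₁ (x , nonIsolated h)

  -- Arcs of the complement of the claw graph are compared after forgetting the (irrelevant) proofs in ClawV.
  base : ClawV → Fin n ⊎ Triple
  base = Sum.map proj₁ proj₁

  base-injective : Injective _≡_ _≡_ base
  base-injective {inj₁ (x , p)} {inj₁ (.x , q)} refl = cong (λ p → inj₁ (x , p)) (T-irrelevant p q)
  base-injective {inj₂ (t , p)} {inj₂ (.t , q)} refl = cong (λ p → inj₂ (t , p)) (T-irrelevant p q)

  H-irrelevant : ∀ u v (h h′ : H u v) → h ≡ h′
  H-irrelevant (inj₁ _) (inj₁ _) = T-irrelevant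
  H-irrelevant (inj₁ _) (inj₂ _) = T-irrelevant
  H-irrelevant (inj₂ _) (inj₁ _) = T-irrelevant

  position : ∀ x t → T (x ∈ᵗ t) → Fin 3
  position x t = proj₁ ∘ ⇔.to (∈ᵗ⇔ x t)

  at-position : ∀ x t (x∈t : T (x ∈ᵗ t)) → x ≡ corner t (position x t x∈t)
  at-position x t = proj₂ ∘ ⇔.to (∈ᵗ⇔ x t)

  ∈ₑ-corners⇒∈ᵗ : ∀ {z} t ij → z ∈ₑ both (corner t) ij → T (z ∈ᵗ t)
  ∈ₑ-corners⇒∈ᵗ {z} t (i , j) = [ (λ z≡ → ⇔.from (∈ᵗ⇔ z t) (i , z≡)) , (λ z≡ → ⇔.from (∈ᵗ⇔ z t) (j , z≡)) ]

  sameTri-intro : ∀ {x y t} → T (isTri t) → T (x ∈ᵗ t) → T (y ∈ᵗ t) → T (sameTri x y)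
  sameTri-intro {x} {y} {t@(a , b , c)} ht x∈t y∈t =
    ⇔.from ∃ᵇ⇔ (a , ⇔.from ∃ᵇ⇔ (b , ⇔.from ∃ᵇ⇔ (c ,
      ⇔.from (T-∧ {isTri t}) (ht , ⇔.from (T-∧ {x ∈ᵗ t}) (x∈t , y∈t)))))

  sameTri-corners : ∀ {x y} t ij → T (isTri t) → (x , y) ≈ᵤ both (corner t) ij → T (sameTri x y)
  sameTri-corners {x} {y} t ij ht xy≈ =
    sameTri-intro {x} {y} ht (∈ₑ-corners⇒∈ᵗ t ij (∈ₑ-resp-≈ᵤ (inj₁ refl) xy≈))
                             (∈ₑ-corners⇒∈ᵗ t ij (∈ₑ-resp-≈ᵤ (inj₂ refl) xy≈))

  sameTri-elim : ∀ {x y} → T (sameTri x y) → ∃ λ t → T (isTri t) × T (x ∈ᵗ t) × T (y ∈ᵗ t)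
  sameTri-elim {x} {y} h =
    let a , h = ⇔.to ∃ᵇ⇔ h
        b , h = ⇔.to ∃ᵇ⇔ h
        c , h = ⇔.to ∃ᵇ⇔ h
        ht , h = ⇔.to (T-∧ {isTri (a , b , c)}) h
    in (a , b , c) , ht , ⇔.to (T-∧ {x ∈ᵗ (a , b , c)}) h

  data Placement (x y : Fin n) : Set where
    outside : ¬ T (sameTri x y) → Placement x y
    inside  : ∀ t → T (isTri t) → ∀ i j → x ≡ corner t i → y ≡ corner t j → Placement x y

  placement : ∀ x y → Placement x y
  placement x y with T? (sameTri x y)
  ... | no ¬st = outside ¬st
  ... | yes st = inside-of (sameTri-elim {x} {y} st)
    where
    inside-of : (∃ λ t → T (isTri t) × T (x ∈ᵗ t) × T (y ∈ᵗ t)) → Placement x y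
    inside-of (t , ht , x∈t , y∈t) =
      inside t ht (position x t x∈t) (position y t y∈t) (at-position x t x∈t) (at-position y t y∈t)

  distinct-positions : ∀ {t i j} → T (cadj (corner t i) (corner t j)) → i ≢ j
  distinct-positions {t} h i≡j = cadj⇒≢ h (cong (corner t) i≡j)

  -- An edge inside a triangle component becomes the spoke from the centre to the opposite corner.
  arcAt : ∀ {x y} → T (cadj x y) → Placement x y → Arc coClaw
  arcAt {x} {y} h (outside ¬st) =
    (vertex h , vertex (cadj-sym h)) , ⇔.from (T-∧ {cadj x y}) (h , ⇔.from T-not ¬st)
  arcAt h (inside t ht i j refl refl) =
    (vertex (corner-cadj {t} ht (opposite-≢ (distinct-positions {t} {i} {j} h))) , inj₂ (t , ht))
    , corner-∈ᵗ t (opposite (i , j))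

  arc : CoEdge → Arc coClaw
  arc ((x , y) , _ , h) = arcAt h (placement x y)

  sideOf : ∀ {t} → T (isTri t) → Fin 3 → Σ (Fin n × Fin n) (T ∘ uncurry cadj)
  sideOf {t} ht k = both (corner t) (side k) , corner-cadj {t} ht (side-distinct k)

  edgeEnds : Arc coClaw → Σ (Fin n × Fin n) (T ∘ uncurry cadj)
  edgeEnds ((inj₁ (x , _) , inj₁ (y , _)) , h) = (x , y) , proj₁ (⇔.to (T-∧ {cadj x y}) h)
  edgeEnds ((inj₁ (x , _) , inj₂ (t , ht)) , h) = sideOf {t} ht (position x t h)
  edgeEnds ((inj₂ (t , ht) , inj₁ (x , _)) , h) = sideOf {t} ht (position x t h)

  edge : Arc coClaw → CoEdge
  edge a = coEdge (proj₂ (edgeEnds a))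

  position-corner : ∀ {t} (ht : T (isTri t)) k (h : T (corner t k ∈ᵗ t)) → position (corner t k) t h ≡ k
  position-corner {t} ht k h = sym (corner-injective {t} ht (at-position (corner t k) t h))

  edge-arcAt : ∀ {x y} (x<y : x < y) (h : T (cadj x y)) p → edge (arcAt h p) ≡ ((x , y) , x<y , h)
  edge-arcAt x<y h (outside _) = CoEdge-≡ (≈ᵤ-sym (coEdge-ends _))
  edge-arcAt x<y h (inside t ht i j refl refl) = CoEdge-≡ (≈ᵤ-trans (≈ᵤ-sym (coEdge-ends _)) side≈)
    where
    k = opposite (i , j)
    side≈ : both (corner t) (side (position (corner t k) t (corner-∈ᵗ t k))) ≈ᵤ both (corner t) (i , j)
    side≈ rewrite position-corner {t} ht k (corner-∈ᵗ t k) =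
      ≈ᵤ-map (corner t) (side-opposite (distinct-positions {t} {i} {j} h))

  edge-arc : ∀ e → edge (arc e) ≡ e
  edge-arc ((x , y) , x<y , h) = edge-arcAt x<y h (placement x y)

  edgeEnds-cong : ∀ a b → ends a ≈ᵤ ends b → proj₁ (edgeEnds a) ≈ᵤ proj₁ (edgeEnds b)
  edgeEnds-cong ((u , v) , h) (_ , h′) (inj₁ (refl , refl)) =
    ≈ᵤ-reflexive (cong (λ h → proj₁ (edgeEnds ((u , v) , h))) (H-irrelevant u v h h′))
  edgeEnds-cong ((inj₁ _ , inj₁ _) , _) ((inj₁ _ , inj₁ _) , _) (inj₂ (refl , refl)) = ≈ᵤ-swap
  edgeEnds-cong ((inj₁ _ , inj₂ _) , h) ((inj₂ _ , inj₁ _) , h′) (inj₂ (refl , refl))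
    rewrite T-irrelevant h h′ = ≈ᵤ-refl
  edgeEnds-cong ((inj₂ _ , inj₁ _) , h) ((inj₁ _ , inj₂ _) , h′) (inj₂ (refl , refl))
    rewrite T-irrelevant h h′ = ≈ᵤ-refl

  edge-cong : ∀ a b → ends a ≈ᵤ ends b → edge a ≡ edge b
  edge-cong a b ab≈ = coEdge-cong _ _ (edgeEnds-cong a b ab≈)

  arcAt-free : ∀ {x y u w} (h : T (cadj x y)) p → (x , y) ≈ᵤ (u , w) → ¬ T (sameTri u w)
    → both base (ends (arcAt h p)) ≈ᵤ (inj₁ u , inj₁ w)
  arcAt-free h (outside _) xy≈ _ = ≈ᵤ-map inj₁ xy≈
  arcAt-free h (inside t ht i j refl refl) xy≈ ¬st = ⊥-elim (¬st (sameTri-corners t (i , j) ht (≈ᵤ-sym xy≈)))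

  arcAt-spoke : ∀ {x y t} (h : T (cadj x y)) p (ht : T (isTri t)) k → (x , y) ≈ᵤ both (corner t) (side k)
    → both base (ends (arcAt h p)) ≡ (inj₁ (corner t k) , inj₂ t)
  arcAt-spoke {t = t} h (outside ¬st) ht k xy≈ = ⊥-elim (¬st (sameTri-corners t (side k) ht xy≈))
  arcAt-spoke {t = t} h (inside t′ ht′ i j refl refl) ht k xy≈
    with refl ← triangle-unique {corner t′ i} {t′} {t} ht′ ht (corner-∈ᵗ t′ i)
                  (∈ₑ-corners⇒∈ᵗ t (side k) (∈ₑ-resp-≈ᵤ (inj₁ refl) xy≈)) =
    cong (λ m → inj₁ (corner t′ m) , inj₂ t′) (trans (opposite-cong ij≈) (opposite-side k))
    where
    ij≈ : (i , j) ≈ᵤ side k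
    ij≈ = ≈ᵤ-map⁻ (corner t′) (corner-injective {t′} ht′) xy≈

  arc-edge-spoke : ∀ x t (ht : T (isTri t)) (x∈t : T (x ∈ᵗ t))
    → both base (ends (arc (coEdge (proj₂ (sideOf {t} ht (position x t x∈t)))))) ≈ᵤ (inj₁ x , inj₂ t)
  arc-edge-spoke x t ht x∈t = ≈ᵤ-reflexive (trans
    (arcAt-spoke {t = t} _ (placement _ _) ht (position x t x∈t) (≈ᵤ-sym (coEdge-ends _)))
    (cong (λ z → inj₁ z , inj₂ t) (sym (at-position x t x∈t))))

  arc-edge : ∀ a → ends (arc (edge a)) ≈ᵤ ends a
  arc-edge a = ≈ᵤ-map⁻ base base-injective (arc-edge-base a)
    where
    arc-edge-base : ∀ a → both base (ends (arc (edge a))) ≈ᵤ both base (ends a)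
    arc-edge-base ((inj₁ (x , _) , inj₁ (y , _)) , h) =
      arcAt-free _ (placement _ _) (≈ᵤ-sym (coEdge-ends _)) (⇔.to T-not (proj₂ (⇔.to (T-∧ {cadj x y}) h)))
    arc-edge-base ((inj₁ (x , _) , inj₂ (t , ht)) , h) = arc-edge-spoke x t ht h
    arc-edge-base ((inj₂ (t , ht) , inj₁ (x , _)) , h) = ≈ᵤ-trans (arc-edge-spoke x t ht h) ≈ᵤ-swap

  outside-avoids : ∀ {u w t} → T (isTri t) → T (cadj u w) → ¬ T (sameTri u w)
    → ∀ {z} → z ∈ₑ (u , w) → ¬ T (z ∈ᵗ t)
  outside-avoids {u} {w} {t} ht h ¬st (inj₁ refl) u∈t =
    ¬st (sameTri-intro {u} {w} ht u∈t (Triangle.closed (triangle {t} ht) u∈t h))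
  outside-avoids {u} {w} {t} ht h ¬st (inj₂ refl) w∈t =
    ¬st (sameTri-intro {u} {w} ht (Triangle.closed (triangle {t} ht) w∈t (cadj-sym h)) w∈t)

  spoke : Triple → Fin 3 × Fin 3 → (Fin n ⊎ Triple) × (Fin n ⊎ Triple)
  spoke t ij = inj₁ (corner t (opposite ij)) , inj₂ t

  inside-outside-apart : ∀ {t i j u w} → T (isTri t) → T (cadj u w) → ¬ T (sameTri u w)
    → ¬ LineAdjacent (both (corner t) (i , j)) (u , w) × ¬ LineAdjacent (spoke t (i , j)) (inj₁ u , inj₁ w)
  inside-outside-apart {t} {i} {j} ht h ¬st = apartₗ , apartᵣ
    where
    apartₗ : ¬ LineAdjacent (both (corner t) (i , j)) _
    apartₗ (_ , z , z∈ij , z∈uw) = outside-avoids {t = t} ht h ¬st z∈uw (∈ₑ-corners⇒∈ᵗ t (i , j) z∈ij)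
    apartᵣ : ¬ LineAdjacent (spoke t (i , j)) _
    apartᵣ (_ , _ , inj₁ refl , c∈uw) =
      outside-avoids {t = t} ht h ¬st (∈ₑ-map⁻ inj₁ inj₁-injective c∈uw) (corner-∈ᵗ t (opposite (i , j)))
    apartᵣ (_ , _ , inj₂ refl , inj₁ ())
    apartᵣ (_ , _ , inj₂ refl , inj₂ ())

  inside-inside-same : ∀ {t t′} ij kl → T (isTri t) → T (isTri t′)
    → LineAdjacent (both (corner t) ij) (both (corner t′) kl) ⊎ LineAdjacent (spoke t ij) (spoke t′ kl)
    → t ≡ t′
  inside-inside-same {t} {t′} ij kl ht ht′ (inj₁ (_ , z , z∈ij , z∈kl)) =
    triangle-unique {z} ht ht′ (∈ₑ-corners⇒∈ᵗ t ij z∈ij) (∈ₑ-corners⇒∈ᵗ t′ kl z∈kl)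
  inside-inside-same {t} {t′} ij kl ht ht′ (inj₂ (_ , _ , inj₁ refl , inj₁ c≡c′)) =
    triangle-unique {corner t (opposite ij)} ht ht′ (corner-∈ᵗ t (opposite ij))
      (subst (λ z → T (z ∈ᵗ t′)) (sym (inj₁-injective c≡c′)) (corner-∈ᵗ t′ (opposite kl)))
  inside-inside-same ij kl ht ht′ (inj₂ (_ , _ , inj₂ refl , inj₂ t≡t′)) = inj₂-injective t≡t′
  inside-inside-same ij kl ht ht′ (inj₂ (_ , _ , inj₁ refl , inj₂ ()))
  inside-inside-same ij kl ht ht′ (inj₂ (_ , _ , inj₂ refl , inj₁ ()))

  inside-inside-adjacent : ∀ {t i j k l} → T (isTri t) → i ≢ j → k ≢ l
    → LineAdjacent (both (corner t) (i , j)) (both (corner t) (k , l))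
      ⇔ LineAdjacent (spoke t (i , j)) (spoke t (k , l))
  inside-inside-adjacent {t} {i} {j} {k} {l} ht i≢j k≢l = begin
    LineAdjacent (both (corner t) (i , j)) (both (corner t) (k , l))
      ≈⟨ LineAdjacent-map (corner t) (corner-injective {t} ht) ⟨
    LineAdjacent (i , j) (k , l)
      ≈⟨ LineAdjacent-opposite i≢j k≢l ⟩
    opposite (i , j) ≢ opposite (k , l)
      ≈⟨ injective⇒≢⇔ (corner-injective {t} ht ∘ inj₁-injective) ⟩
    inj₁ (corner t (opposite (i , j))) ≢ inj₁ (corner t (opposite (k , l)))
      ≈⟨ LineAdjacent-sharedʳ ⟨
    LineAdjacent (spoke t (i , j)) (spoke t (k , l))
      ∎
    where open ⇔-Reasoning

  adjacentAt : ∀ {x y u w} (h : T (cadj x y)) (h′ : T (cadj u w)) p p′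
    → LineAdjacent (x , y) (u , w) ⇔ LineAdjacent (both base (ends (arcAt h p))) (both base (ends (arcAt h′ p′)))
  adjacentAt h h′ (outside _) (outside _) = LineAdjacent-map inj₁ inj₁-injective
  adjacentAt h h′ (inside t ht i j refl refl) (outside ¬st) =
    let apartₗ , apartᵣ = inside-outside-apart {t} {i} {j} ht h′ ¬st
    in mk⇔ (⊥-elim ∘ apartₗ) (⊥-elim ∘ apartᵣ)
  adjacentAt h h′ (outside ¬st) (inside t ht i j refl refl) =
    let apartₗ , apartᵣ = inside-outside-apart {t} {i} {j} ht h ¬st
    in mk⇔ (⊥-elim ∘ apartₗ ∘ LineAdjacent-sym) (⊥-elim ∘ apartᵣ ∘ LineAdjacent-sym)
  adjacentAt h h′ (inside t ht i j refl refl) (inside t′ ht′ k l refl refl) =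
    mk⇔ (λ adj → ⇔.to (same-triangle (inj₁ adj)) adj) (λ adj → ⇔.from (same-triangle (inj₂ adj)) adj)
    where
    sides = LineAdjacent (both (corner t) (i , j)) (both (corner t′) (k , l))
    spokes = LineAdjacent (spoke t (i , j)) (spoke t′ (k , l))
    same-triangle : sides ⊎ spokes → sides ⇔ spokes
    same-triangle adj with refl ← inside-inside-same (i , j) (k , l) ht ht′ adj =
      inside-inside-adjacent {t} {i} {j} {k} {l} ht (distinct-positions {t} h) (distinct-positions {t} h′)

  H? : ∀ u v → Dec (H u v)
  H? (inj₁ _) (inj₁ _) = T? _
  H? (inj₁ _) (inj₂ _) = T? _
  H? (inj₂ _) (inj₁ _) = T? _
  H? (inj₂ _) (inj₂ _) = no id

  H-irreflexive : ∀ u → ¬ H u u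
  H-irreflexive (inj₁ (x , _)) h = cadj⇒≢ (proj₁ (⇔.to (T-∧ {cadj x x}) h)) refl

  LineOfComplement-isLineGraph : IsLineGraph LineOfComplement coClaw
  LineOfComplement-isLineGraph = record
    { edge      = edge
    ; arc       = arc
    ; edge-arc  = edge-arc
    ; arc-edge  = arc-edge
    ; edge-cong = edge-cong
    ; adjacent  = λ where
        ((x , y) , _ , h) ((u , w) , _ , h′) →
          ⇔-sym (LineAdjacent-map base base-injective) ⇔-∘ adjacentAt h h′ (placement x y) (placement u w)
    }

-- Independent set partitions with at least n − 1 parts

module _ {A : Set} {P : A → Set} (P? : U.Decidable P) where

  filter-rejects-two : ∀ {u w xs} → u ∈ xs → w ∈ xs → u ≢ w → ¬ P u → ¬ P w
    → 2 + length (filter P? xs) ≤ length xs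
  filter-rejects-two (here refl) (here refl) u≢w _ _ = ⊥-elim (u≢w refl)
  filter-rejects-two {xs = _ ∷ xs} (here refl) (there w∈) _ ¬Pu ¬Pw
    rewrite filter-reject P? {xs = xs} ¬Pu = s≤s (filter-notAll P? xs (lose w∈ ¬Pw))
  filter-rejects-two {xs = _ ∷ xs} (there u∈) (here refl) _ ¬Pu ¬Pw
    rewrite filter-reject P? {xs = xs} ¬Pw = s≤s (filter-notAll P? xs (lose u∈ ¬Pu))
  filter-rejects-two {xs = x ∷ _} (there u∈) (there w∈) u≢w ¬Pu ¬Pw with P? x
  ... | yes _ = s≤s (filter-rejects-two u∈ w∈ u≢w ¬Pu ¬Pw)
  ... | no _  = ℕ.m≤n⇒m≤1+n (filter-rejects-two u∈ w∈ u≢w ¬Pu ¬Pw)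

  filter-accepts-all-but-one : ∀ {y xs} → Unique xs → (∀ z → z ≢ y → P z)
    → length xs ≤ 1 + length (filter P? xs)
  filter-accepts-all-but-one {xs = []} _ _ = z≤n
  filter-accepts-all-but-one {y} {x ∷ xs} (x∉xs ∷ unique) accepts with P? x
  ... | yes _ = s≤s (filter-accepts-all-but-one unique accepts)
  ... | no ¬Px = s≤s (ℕ.≤-reflexive (sym (cong length (filter-all P? (All.map accepted x∉xs)))))
    where
    accepted : ∀ {z} → x ≢ z → P z
    accepted {z} x≢z = accepts z λ z≡y → ¬Px (accepts x λ x≡y → x≢z (trans x≡y (sym z≡y)))

module BellPartitions {n : ℕ} (G : Graph n) where
  open Bell G
  open ComplementEdges G

  tabulateRel : (Fin n → Fin n → Bool) → Rel
  tabulateRel r = tabulate (tabulate ∘ r)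

  rel-tabulateRel : ∀ r x y → rel (tabulateRel r) x y ≡ r x y
  rel-tabulateRel r x y = trans (cong (λ row → lookup row y) (lookup∘tabulate _ x)) (lookup∘tabulate _ y)

  Rel-ext : ∀ {R R′} → (∀ x y → rel R x y ≡ rel R′ x y) → R ≡ R′
  Rel-ext {R} {R′} eq = begin
    R                     ≡⟨ tabulateRel-rel R ⟨
    tabulateRel (rel R)   ≡⟨ tabulate-cong (λ x → tabulate-cong (eq x)) ⟩
    tabulateRel (rel R′)  ≡⟨ tabulateRel-rel R′ ⟩
    R′                    ∎
    where
    open ≡-Reasoning
    tabulateRel-rel : ∀ R → tabulateRel (rel R) ≡ R
    tabulateRel-rel R = trans (tabulate-cong (tabulate∘lookup ∘ lookup R)) (tabulate∘lookup R)

  record IsISPartition (R : Rel) : Set where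
    field
      reflexive   : ∀ x → T (rel R x x)
      symmetric   : ∀ {x y} → T (rel R x y) → T (rel R y x)
      transitive  : ∀ {x y z} → T (rel R x y) → T (rel R y z) → T (rel R x z)
      independent : ∀ {x y} → T (rel R x y) → ¬ T (adj G x y)

  isISPartition⇔ : ∀ R → T (isISPartition R) ⇔ IsISPartition R
  isISPartition⇔ R = mk⇔ decode encode
    where
    r = rel R
    clause⇔ : ∀ x y z
      → T (r x x ∧ (not (r x y) ∨ r y x) ∧ (not (r x y) ∨ not (r y z) ∨ r x z) ∧ (not (r x y) ∨ not (adj G x y)))
      ⇔ (T (r x x) × (T (r x y) → T (r y x)) × (T (r x y) → T (r y z) → T (r x z)) × (T (r x y) → ¬ T (adj G x y)))
    clause⇔ x y z = (⇔-id _ ×-⇔ T-implies ×-⇔ T-implies₂ ×-⇔ T-implies-not)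
      ⇔-∘ T-∧⁴ (r x x) (not (r x y) ∨ r y x) (not (r x y) ∨ not (r y z) ∨ r x z) (not (r x y) ∨ not (adj G x y))
    decode : T (isISPartition R) → IsISPartition R
    decode h = record
      { reflexive   = λ x → proj₁ (clause x x x)
      ; symmetric   = λ {x} {y} → proj₁ (proj₂ (clause x y x))
      ; transitive  = λ {x} {y} {z} → proj₁ (proj₂ (proj₂ (clause x y z)))
      ; independent = λ {x} {y} → proj₂ (proj₂ (proj₂ (clause x y x)))
      }
      where
      clause : ∀ x y z → _
      clause x y z = ⇔.to (clause⇔ x y z) (⇔.to ∀ᵇ⇔ (⇔.to ∀ᵇ⇔ (⇔.to ∀ᵇ⇔ h x) y) z)
    encode : IsISPartition R → T (isISPartition R)
    encode isP = ⇔.from ∀ᵇ⇔ λ x → ⇔.from ∀ᵇ⇔ λ y → ⇔.from ∀ᵇ⇔ λ z →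
      ⇔.from (clause⇔ x y z) (reflexive x , symmetric , transitive , independent)
      where open IsISPartition isP

  leastᵇ : Rel → Fin n → Bool
  leastᵇ R x = ∀ᵇ λ y → not (toℕ y <ᵇ toℕ x) ∨ not (rel R x y)

  least⇔ : ∀ R x → T (leastᵇ R x) ⇔ (∀ y → y < x → ¬ T (rel R x y))
  least⇔ R x = mk⇔
    (λ h y y<x → ⇔.to T-implies-not (⇔.to ∀ᵇ⇔ h y) (<⇒<ᵇ y<x))
    (λ f → ⇔.from ∀ᵇ⇔ λ y → ⇔.from (T-implies-not {toℕ y <ᵇ toℕ x}) (f y ∘ <ᵇ⇒< _ _))

  related-below⇒¬least : ∀ R {x y} → y < x → T (rel R x y) → ¬ T (leastᵇ R x)
  related-below⇒¬least R {x} y<x r least = ⇔.to (least⇔ R x) least _ y<x r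

  numParts-all-least : ∀ R → (∀ x → T (leastᵇ R x)) → numParts R ≡ n
  numParts-all-least R least =
    trans (cong length (filter-all (T? ∘ leastᵇ R) {allFin n} (All.tabulate (λ {x} _ → least x))))
          (length-tabulate {n = n} id)

  numParts-all-but-one-least : ∀ R y → (∀ x → x ≢ y → T (leastᵇ R x)) → n ∸ 1 ≤ numParts R
  numParts-all-but-one-least R y least =
    ℕ.∸-monoˡ-≤ {n} {1 + numParts R} 1 (subst (_≤ 1 + numParts R) (length-tabulate {n = n} id)
      (filter-accepts-all-but-one (T? ∘ leastᵇ R) {xs = allFin n} (allFin⁺ n) least))

  ¬least-unique : ∀ R → n ∸ 1 ≤ numParts R → ∀ {u w} → ¬ T (leastᵇ R u) → ¬ T (leastᵇ R w) → u ≡ w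
  ¬least-unique R bound {u} {w} ¬lu ¬lw with u ≟ w
  ... | yes u≡w = u≡w
  ... | no u≢w  = ⊥-elim (too-few n bound (subst (2 + numParts R ≤_) (length-tabulate {n = n} id)
                    (filter-rejects-two (T? ∘ leastᵇ R) {xs = allFin n} (∈-allFin u) (∈-allFin w) u≢w ¬lu ¬lw)))
    where
    too-few : ∀ m {k} → m ∸ 1 ≤ k → 2 + k ≤ m → ⊥
    too-few (suc m) m≤k (s≤s 1+k≤m) = ℕ.<-irrefl refl (ℕ.≤-trans 1+k≤m m≤k)

  Merged : ⊤ ⊎ CoEdge → Fin n → Fin n → Set
  Merged (inj₁ _) _ _ = ⊥
  Merged (inj₂ e) a b = (a , b) ≈ᵤ proj₁ e

  Joined : ⊤ ⊎ CoEdge → Fin n → Fin n → Set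
  Joined s a b = a ≡ b ⊎ Merged s a b

  Joined? : ∀ s a b → Dec (Joined s a b)
  Joined? (inj₁ _) a b = (a ≟ b) ⊎-dec no id
  Joined? (inj₂ e) a b = (a ≟ b) ⊎-dec ≈ᵤ? _≟_ (a , b) (proj₁ e)

  Joined-sym : ∀ s {a b} → Joined s a b → Joined s b a
  Joined-sym _        (inj₁ refl) = inj₁ refl
  Joined-sym (inj₂ _) (inj₂ ab≈)  = inj₂ (≈ᵤ-trans ≈ᵤ-swap ab≈)

  Joined-trans : ∀ s {a b c} → Joined s a b → Joined s b c → Joined s a c
  Joined-trans _ (inj₁ refl) bc          = bc
  Joined-trans _ ab          (inj₁ refl) = ab
  Joined-trans (inj₂ (_ , x<y , _)) (inj₂ (inj₁ (refl , refl))) (inj₂ (inj₁ (y≡x , _))) =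
    ⊥-elim (<⇒≢ x<y (sym y≡x))
  Joined-trans (inj₂ _) (inj₂ (inj₁ (refl , refl))) (inj₂ (inj₂ (_ , c≡x))) = inj₁ (sym c≡x)
  Joined-trans (inj₂ _) (inj₂ (inj₂ (refl , refl))) (inj₂ (inj₁ (_ , c≡y))) = inj₁ (sym c≡y)
  Joined-trans (inj₂ (_ , x<y , _)) (inj₂ (inj₂ (refl , refl))) (inj₂ (inj₂ (x≡y , _))) =
    ⊥-elim (<⇒≢ x<y x≡y)

  Joined-independent : ∀ s {a b} → Joined s a b → ¬ T (adj G a b)
  Joined-independent _ {a} (inj₁ refl) = subst T (Graph.irrefl G a)
  Joined-independent (inj₂ (_ , _ , h)) (inj₂ (inj₁ (refl , refl))) = proj₁ (⇔.to cadj⇔ h)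
  Joined-independent (inj₂ (_ , _ , h)) (inj₂ (inj₂ (refl , refl))) = proj₁ (⇔.to cadj⇔ (cadj-sym h))

  partition : ⊤ ⊎ CoEdge → Rel
  partition s = tabulateRel λ a b → ⌊ Joined? s a b ⌋

  T-partition : ∀ s {a b} → T (rel (partition s) a b) ⇔ Joined s a b
  T-partition s {a} {b} = subst (λ β → T β ⇔ Joined s a b) (sym (rel-tabulateRel _ a b)) T-⌊⌋

  partition-isISPartition : ∀ s → IsISPartition (partition s)
  partition-isISPartition s = record
    { reflexive   = λ _ → ⇔.from (T-partition s) (inj₁ refl)
    ; symmetric   = ⇔.from (T-partition s) ∘ Joined-sym s ∘ ⇔.to (T-partition s)
    ; transitive  = λ r r′ →
        ⇔.from (T-partition s) (Joined-trans s (⇔.to (T-partition s) r) (⇔.to (T-partition s) r′))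
    ; independent = Joined-independent s ∘ ⇔.to (T-partition s)
    }

  partition-bound : ∀ s → n ∸ 1 ≤ numParts (partition s)
  partition-bound s@(inj₁ tt) =
    ℕ.≤-trans (ℕ.m∸n≤m n 1) (ℕ.≤-reflexive (sym (numParts-all-least (partition s) least)))
    where
    least : ∀ x → T (leastᵇ (partition s) x)
    least x = ⇔.from (least⇔ (partition s) x) λ y y<x r →
      [ (λ x≡y → <⇒≢ y<x (sym x≡y)) , (λ ()) ] (⇔.to (T-partition s) r)
  partition-bound s@(inj₂ ((x , y) , x<y , _)) = numParts-all-but-one-least (partition s) y least
    where
    least : ∀ z → z ≢ y → T (leastᵇ (partition s) z)
    least z z≢y = ⇔.from (least⇔ (partition s) z) λ w w<z r → case ⇔.to (T-partition s) r of λ where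
      (inj₁ z≡w)                 → <⇒≢ w<z (sym z≡w)
      (inj₂ (inj₁ (refl , refl))) → <-asym x<y w<z
      (inj₂ (inj₂ (z≡y , _)))     → z≢y z≡y

  part : ⊤ ⊎ CoEdge → V (B≥ (n ∸ 1))
  part s = (partition s , ⇔.from (isISPartition⇔ (partition s)) (partition-isISPartition s)) , partition-bound s

  RelatedPair : Rel → Set
  RelatedPair R = ∃ λ x → ∃ λ y → x < y × T (rel R x y)

  classifyWith : ∀ R → IsISPartition R → Dec (RelatedPair R) → ⊤ ⊎ CoEdge
  classifyWith R isP (no _)                  = inj₁ tt
  classifyWith R isP (yes (x , y , x<y , r)) =
    inj₂ ((x , y) , x<y , ⇔.from cadj⇔ (IsISPartition.independent isP r , <⇒≢ x<y))

  classify : ISPartition → ⊤ ⊎ CoEdge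
  classify (R , isP) =
    classifyWith R (⇔.to (isISPartition⇔ R) isP) (any? λ x → any? λ y → (x <? y) ×-dec T? (rel R x y))

  classify-part : ∀ s → classify (proj₁ (part s)) ≡ s
  classify-part s = classifyWith-partition s _ _
    where
    classifyWith-partition : ∀ s isP d → classifyWith (partition s) isP d ≡ s
    classifyWith-partition (inj₁ tt) _ (no _) = refl
    classifyWith-partition (inj₁ tt) _ (yes (x , y , x<y , r)) =
      ⊥-elim ([ <⇒≢ x<y , (λ ()) ] (⇔.to (T-partition (inj₁ tt)) r))
    classifyWith-partition s@(inj₂ ((x , y) , x<y , _)) _ (no ¬pair) =
      ⊥-elim (¬pair (x , y , x<y , ⇔.from (T-partition s) (inj₂ ≈ᵤ-refl)))
    classifyWith-partition s@(inj₂ _) _ (yes (u , w , u<w , r)) with ⇔.to (T-partition s) r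
    ... | inj₁ u≡w = ⊥-elim (<⇒≢ u<w u≡w)
    ... | inj₂ uw≈ = cong inj₂ (CoEdge-≡ uw≈)

  -- With at least n − 1 parts, the related pair found is the only non-singleton part.
  classifyWith-joined : ∀ R isP → n ∸ 1 ≤ numParts R
    → ∀ d a b → Joined (classifyWith R isP d) a b ⇔ T (rel R a b)
  classifyWith-joined R isP _ (no ¬pair) a b = mk⇔ [ (λ { refl → reflexive a }) , (λ ()) ] singleton
    where
    open IsISPartition isP
    singleton : T (rel R a b) → a ≡ b ⊎ ⊥
    singleton r with <-cmp a b
    ... | tri< a<b _ _ = ⊥-elim (¬pair (a , b , a<b , r))
    ... | tri≈ _ a≡b _ = inj₁ a≡b
    ... | tri> _ _ b<a = ⊥-elim (¬pair (b , a , b<a , symmetric r))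
  classifyWith-joined R isP bound (yes (x , y , x<y , rxy)) a b = mk⇔ joined⇒rel rel⇒joined
    where
    open IsISPartition isP
    s = classifyWith R isP (yes (x , y , x<y , rxy))
    joined⇒rel : Joined s a b → T (rel R a b)
    joined⇒rel (inj₁ refl)                 = reflexive a
    joined⇒rel (inj₂ (inj₁ (refl , refl))) = rxy
    joined⇒rel (inj₂ (inj₂ (refl , refl))) = symmetric rxy
    avoids-y : ∀ {c d} → c ≢ d → T (rel R c d) → c ≢ y → d ≢ y → ⊥
    avoids-y {c} {d} c≢d r c≢y d≢y with <-cmp c d
    ... | tri< c<d _ _ = d≢y (¬least-unique R bound (related-below⇒¬least R c<d (symmetric r)) y-not-least)
      where y-not-least = related-below⇒¬least R x<y (symmetric rxy)
    ... | tri≈ _ c≡d _ = c≢d c≡d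
    ... | tri> _ _ d<c = c≢y (¬least-unique R bound (related-below⇒¬least R d<c r) y-not-least)
      where y-not-least = related-below⇒¬least R x<y (symmetric rxy)
    only-pair : a ≢ b → T (rel R a b) → ¬ (a , b) ≈ᵤ (x , y) → ⊥
    only-pair a≢b r ¬≈ with a ≟ y | b ≟ y
    ... | yes refl | _       = avoids-y (λ { refl → ¬≈ ≈ᵤ-swap }) (transitive rxy r) (<⇒≢ x<y) (a≢b ∘ sym)
    ... | no a≢y   | yes refl = avoids-y (λ { refl → ¬≈ ≈ᵤ-refl }) (transitive rxy (symmetric r)) (<⇒≢ x<y) a≢y
    ... | no a≢y   | no b≢y   = avoids-y a≢b r a≢y b≢y
    rel⇒joined : T (rel R a b) → Joined s a b
    rel⇒joined r with a ≟ b | ≈ᵤ? _≟_ (a , b) (x , y)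
    ... | yes a≡b | _       = inj₁ a≡b
    ... | no _    | yes ab≈ = inj₂ ab≈
    ... | no a≢b  | no ¬≈   = ⊥-elim (only-pair a≢b r ¬≈)

  part-classify : ∀ P → part (classify (proj₁ P)) ≡ P
  part-classify P@((R , isP) , bound) = B≥-vertex-≡ (Rel-ext λ a b →
    T-injective (classifyWith-joined R _ bound _ a b ⇔-∘ T-partition (classify (proj₁ P))))
    where
    B≥-vertex-≡ : ∀ {Q : V (B≥ (n ∸ 1))} → proj₁ (proj₁ Q) ≡ R → Q ≡ P
    B≥-vertex-≡ {(_ , isQ) , bound′} refl =
      cong₂ (λ i b → (R , i) , b) (T-irrelevant isQ isP) (ℕ.≤-irrelevant bound′ bound)

  -- Deleting a pivot of s from its partition leaves the discrete partition.
  Pivot : ⊤ ⊎ CoEdge → Fin n → Set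
  Pivot (inj₁ _) _ = ⊤
  Pivot (inj₂ e) v = v ∈ₑ proj₁ e

  joined-off-pivot : ∀ s {v a b} → Pivot s v → a ≢ v → b ≢ v → Joined s a b → a ≡ b
  joined-off-pivot _        _           _   _   (inj₁ a≡b)                = a≡b
  joined-off-pivot (inj₂ _) (inj₁ refl) a≢v _   (inj₂ (inj₁ (a≡x , _)))   = ⊥-elim (a≢v a≡x)
  joined-off-pivot (inj₂ _) (inj₁ refl) _   b≢v (inj₂ (inj₂ (_ , b≡x)))   = ⊥-elim (b≢v b≡x)
  joined-off-pivot (inj₂ _) (inj₂ refl) _   b≢v (inj₂ (inj₁ (_ , b≡y)))   = ⊥-elim (b≢v b≡y)
  joined-off-pivot (inj₂ _) (inj₂ refl) a≢v _   (inj₂ (inj₂ (a≡y , _)))   = ⊥-elim (a≢v a≡y)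

  SameMinus : ⊤ ⊎ CoEdge → ⊤ ⊎ CoEdge → Fin n → Set
  SameMinus s s′ = sameMinus (proj₁ (part s)) (proj₁ (part s′))

  pivots⇒sameMinus : ∀ s s′ {v} → Pivot s v → Pivot s′ v → SameMinus s s′ v
  pivots⇒sameMinus s s′ p p′ a b a≢v b≢v =
    T-injective (⇔-sym (T-partition s′) ⇔-∘ (off-pivot ⇔-∘ T-partition s))
    where
    off-pivot : Joined s a b ⇔ Joined s′ a b
    off-pivot = mk⇔ (inj₁ ∘ joined-off-pivot s p a≢v b≢v) (inj₁ ∘ joined-off-pivot s′ p′ a≢v b≢v)

  sameMinus⇒pivot : ∀ s s′ {v} → s ≢ s′ → SameMinus s s′ v → Pivot s v
  sameMinus⇒pivot (inj₁ _) _ _ _ = tt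
  sameMinus⇒pivot s@(inj₂ ((x , y) , x<y , _)) s′ {v} s≢s′ same with (v ≟ x) ⊎-dec (v ≟ y)
  ... | yes v∈xy = v∈xy
  ... | no v∉xy  = ⊥-elim (not-joined s′ s≢s′ (⇔.to (T-partition s′) joined′))
    where
    joined′ : T (rel (partition s′) x y)
    joined′ = subst T (same x y (v∉xy ∘ inj₁ ∘ sym) (v∉xy ∘ inj₂ ∘ sym)) (⇔.from (T-partition s) (inj₂ ≈ᵤ-refl))
    not-joined : ∀ s′ → s ≢ s′ → Joined s′ x y → ⊥
    not-joined _          _ (inj₁ x≡y) = <⇒≢ x<y x≡y
    not-joined (inj₂ e′) s≢s′ (inj₂ xy≈) = s≢s′ (cong inj₂ (CoEdge-≡ xy≈))

  Touching : ⊤ ⊎ CoEdge → ⊤ ⊎ CoEdge → Set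
  Touching s s′ = s ≢ s′ × ∃ λ v → Pivot s v × Pivot s′ v

  part-adjacent⇔ : ∀ s s′ → E (B≥ (n ∸ 1)) (part s) (part s′) ⇔ Touching s s′
  part-adjacent⇔ s s′ = mk⇔
    (λ (P≢Q , v , same) → P≢Q ∘ cong (proj₁ ∘ part) , v ,
       sameMinus⇒pivot s s′ (P≢Q ∘ cong (proj₁ ∘ part)) same ,
       sameMinus⇒pivot s′ s (P≢Q ∘ cong (proj₁ ∘ part) ∘ sym) (λ a b a≢v b≢v → sym (same a b a≢v b≢v)))
    (λ (s≢s′ , v , p , p′) → s≢s′ ∘ part-injective , v , pivots⇒sameMinus s s′ p p′)
    where
    part-injective : proj₁ (part s) ≡ proj₁ (part s′) → s ≡ s′
    part-injective eq = trans (sym (classify-part s)) (trans (cong classify eq) (classify-part s′))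

  ConeE⇔ : ∀ s s′ → ConeE LineOfComplement s s′ ⇔ Touching s s′
  ConeE⇔ (inj₁ _) (inj₁ _) = mk⇔ ⊥-elim (λ (s≢s′ , _) → s≢s′ refl)
  ConeE⇔ (inj₁ _) (inj₂ ((x , _) , _)) = mk⇔ (λ _ → (λ ()) , x , tt , inj₁ refl) _
  ConeE⇔ (inj₂ ((x , _) , _)) (inj₁ _) = mk⇔ (λ _ → (λ ()) , x , inj₁ refl , tt) _
  ConeE⇔ (inj₂ e) (inj₂ e′) = distinct ×-⇔ ⇔-id _
    where
    distinct : (¬ proj₁ e ≈ᵤ proj₁ e′) ⇔ (inj₂ e ≢ inj₂ e′)
    distinct = mk⇔ (λ e≉e′ e≡e′ → e≉e′ (≈ᵤ-reflexive (cong proj₁ (inj₂-injective e≡e′))))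
                   (λ e≢e′ e≈e′ → e≢e′ (cong inj₂ (CoEdge-≡ e≈e′)))

  Cone-LineOfComplement-≅ : Cone LineOfComplement ≅ B≥ (n ∸ 1)
  Cone-LineOfComplement-≅ =
    mk↔ₛ′ part (classify ∘ proj₁) part-classify classify-part
    , λ s s′ → ⇔-sym (part-adjacent⇔ s s′) ⇔-∘ ConeE⇔ s s′

open ComplementEdges using (LineOfComplement)
open ClawComplement using (coClaw; H?; H-irreflexive; LineOfComplement-isLineGraph)
open BellPartitions using (Cone-LineOfComplement-≅)

lemmaA2 : (n₁ n₂ : ℕ) (G₁ : Graph n₁) (G₂ : Graph n₂)
    → (G₁ ᶜˡᵃʷ) ≅ (G₂ ᶜˡᵃʷ)
    → 𝓑≥ G₁ (n₁ ∸ 1) ≅ 𝓑≥ G₂ (n₂ ∸ 1)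
lemmaA2 n₁ n₂ G₁ G₂ claw≅claw = begin
  𝓑≥ G₁ (n₁ ∸ 1)             ≈⟨ Cone-LineOfComplement-≅ G₁ ⟨
  Cone (LineOfComplement G₁) ≈⟨ Cone-cong line≅line ⟩
  Cone (LineOfComplement G₂) ≈⟨ Cone-LineOfComplement-≅ G₂ ⟩
  𝓑≥ G₂ (n₂ ∸ 1)             ∎
  where
  open ≅-Reasoning
  coClaw≅coClaw : coClaw G₁ ≅ coClaw G₂
  coClaw≅coClaw =
    complement-reflects-≅ (H? G₁) (H? G₂) (H-irreflexive G₁) (H-irreflexive G₂) claw≅claw
  line≅line : LineOfComplement G₁ ≅ LineOfComplement G₂
  line≅line =
    IsLineGraph-≅ (LineOfComplement-isLineGraph G₁) (LineOfComplement-isLineGraph G₂) coClaw≅coClaw
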